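{- Let $\tau=\{E\}\subseteq\sigma$ with $\sigma$ a finite relational signature, and let $p(\bar x)$ be a closure type over $\sigma$. Then there is a self-contained closure type $p^*(\bar x,\bar y)$ over $\sigma$ such that $$\models_{tree}\ \forall\bar x\big(p(\bar x)\leftrightarrow\exists!\bar y\,p^*(\bar x,\bar y)\big),$$ where $\exists!\bar y$ means "there exists a unique $\bar y$". Consequently, for every $\sigma$-structure $\mathcal{A}$ expanding a tree, $|p(\mathcal{A})|=|p^*(\mathcal{A})|$, and if $\bar x=\bar u\bar v$ and $\bar a\in A^{|\bar u|}$ then $|p(\bar a,\mathcal{A})|=|p^*(\bar a,\mathcal{A})|$.
   Context: A tree is a finite $\tau$-structure ($\tau=\{E\}$, $E$ binary) with $E$ irreflexive and asymmetric, a unique root (no $E$-predecessor), a unique parent for each non-root vertex, and no directed $E$-cycles; ancestors are vertices from which there is a directed path of length $\ge1$. A fixed $\Delta\in\mathbb{N}^+$ bounds the height of all trees. $\mathrm{cl}(B)$ is $B$ together with the root and all ancestors of members of $B$; $B$ is closed if $\mathrm{cl}(B)=B$; "$\{z_1,\ldots,z_l\}$ is closed" is the formula $\forall z((\bigvee_iE(z,z_i))\to\bigvee_iz=z_i)$, and "$x\in\mathrm{cl}(\bar y)$" is first-order expressible (given height $\le\Delta$). For $0/1$-valued formulas, $\varphi\models_{tree}\psi$ means every $\sigma$-structure expanding a tree (of height $\le\Delta$) and tuple satisfying $\varphi$ satisfies $\psi$; $\models_{tree}\psi$ means $\forall\bar x\psi$ holds in all such structures. An atomic type over $\sigma$ is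 a conjunction $\varphi(x_1,\ldots,x_k)$ of $\sigma$-literals containing $E(x_i,x_j)$ or $\neg E(x_i,x_j)$ for all $i,j$ and $x_i\ne x_j$ for all distinct $i,j$, satisfiable in some $\sigma$-structure expanding a tree. A closure type over $\sigma$ is a formula equivalent to $\exists y_1\ldots y_m(\varphi(\bar x,\bar y)\wedge\text{``}\{\bar x,\bar y\}\text{ is closed''})$ with $\varphi$ an atomic type over $\sigma$ and $\varphi\models y_i\in\mathrm{cl}(\bar x)$ for all $i$ ($m=0$ allowed; if $\bar x$ is empty then $m=1$ and $y_1$ is the root). A closure type $p(\bar x)$ is self-contained if it implies "$\bar x$ is closed". $p(\mathcal{A})$ is the set of tuples satisfying $p$ in $\mathcal{A}$, and $p(\bar a,\mathcal{A})$ the set of $\bar b$ with $\mathcal{A}\models p(\bar a,\bar b)$. -}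

module Defs where

open import Data.Nat using (ℕ; zero; suc; _+_)
open import Data.Nat.Properties using (+-assoc)
open import Data.Fin using (Fin)
open import Data.Bool using (Bool; true; false; T)
open import Data.Maybe using (Maybe; just)
open import Data.Vec using (Vec; []; _∷_; lookup; _++_; map)
open import Data.List as L using (List; length; filter; concatMap; allFin)
open import Data.Product using (Σ; _×_; ∃; ∃!)
open import Data.Sum using (_⊎_)
open import Relation.Binary.PropositionalEquality using (_≡_; trans; sym; cong)
open import Relation.Nullary using (¬_)
open import Relation.Unary using (Decidable)

-- Signatures: σ = {E} ∪ {R_r | r : Fin nrel}, E binary, R_r of arity ar r.

record Sig : Set where
  field
    nrel : ℕ
    ar   : Fin nrel → ℕ
open Sig public

record Str (σ : Sig) : Set where
  field
    N   : ℕ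
    E   : Fin N → Fin N → Bool
    Rel : (r : Fin (nrel σ)) → Vec (Fin N) (ar σ r) → Bool
open Str public

module _ {σ : Sig} (A : Str σ) where

  Edge : Fin (N A) → Fin (N A) → Set
  Edge x y = T (E A x y)

  data Path : ℕ → Fin (N A) → Fin (N A) → Set where
    here : ∀ {x} → Path zero x x
    step : ∀ {n x y z} → Edge x y → Path n y z → Path (suc n) x z

  IsRoot : Fin (N A) → Set
  IsRoot r = ∀ z → ¬ Edge z r

  Ancestor : Fin (N A) → Fin (N A) → Set
  Ancestor x y = Σ ℕ λ n → Path (suc n) x y

  IsTree : Set
  IsTree =
    (∀ x → ¬ Edge x x) ×
    (∀ x y → Edge x y → ¬ Edge y x) ×
    (∃! _≡_ IsRoot) ×
    (∀ x → ¬ IsRoot x → ∃! _≡_ (λ z → Edge z x)) ×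
    (∀ n x → ¬ Path (suc n) x x)

  HeightLE : ℕ → Set
  HeightLE Δ = ∀ x y → ¬ Path (suc Δ) x y

  InCl : ∀ {k} → Fin (N A) → Vec (Fin (N A)) k → Set
  InCl x bs = (Σ (Fin _) λ i → x ≡ lookup bs i) ⊎ IsRoot x
              ⊎ (Σ (Fin _) λ i → Ancestor x (lookup bs i))

  Closed : ∀ {n} → Vec (Fin (N A)) n → Set
  Closed s = ∀ z i → Edge z (lookup s i) → Σ (Fin _) λ j → z ≡ lookup s j

TreeStr : (σ : Sig) (Δ : ℕ) → Str σ → Set
TreeStr σ Δ A = IsTree A × HeightLE A Δ

-- A conjunction of σ-literals is given by: for every pair (i,j) the
-- E-literal (E(x_i,x_j) if true, ¬E(x_i,x_j) if false; all present), for
-- every other symbol R and tuple of variables whether R(t) / ¬R(t) / no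
-- literal occurs; the literals x_i ≠ x_j (i ≠ j) are always present.

record Conj (σ : Sig) (n : ℕ) : Set where
  field
    eLit : Fin n → Fin n → Bool
    rLit : (r : Fin (nrel σ)) → Vec (Fin n) (ar σ r) → Maybe Bool
open Conj public

SatConj : ∀ {σ n} (A : Str σ) → Conj σ n → Vec (Fin (N A)) n → Set
SatConj {σ} A φ a =
  (∀ i j → lookup a i ≡ lookup a j → i ≡ j) ×
  (∀ i j → E A (lookup a i) (lookup a j) ≡ eLit φ i j) ×
  (∀ r t b → rLit φ r t ≡ just b → Rel A r (map (lookup a) t) ≡ b)

IsAtomicType : ∀ {σ n} → ℕ → Conj σ n → Set
IsAtomicType {σ} Δ φ =
  Σ (Str σ) λ A → TreeStr σ Δ A × Σ (Vec (Fin (N A)) _) λ a → SatConj A φ a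

record ClosureType (σ : Sig) (Δ : ℕ) (k : ℕ) : Set where
  field
    m      : ℕ
    φ      : Conj σ (k + m)
    atomic : IsAtomicType Δ φ
    inCl   : ∀ (A : Str σ) → TreeStr σ Δ A →
             ∀ (a : Vec (Fin (N A)) k) (b : Vec (Fin (N A)) m) →
             SatConj A φ (a ++ b) → ∀ i → InCl A (lookup b i) a
    empty  : k ≡ 0 → m ≡ 1
open ClosureType public

Sat : ∀ {σ Δ k} → ClosureType σ Δ k → (A : Str σ) → Vec (Fin (N A)) k → Set
Sat p A a = Σ (Vec (Fin (N A)) (m p)) λ b →
  SatConj A (φ p) (a ++ b) × Closed A (a ++ b)

SelfContained : ∀ {σ Δ k} → ClosureType σ Δ k → Set
SelfContained {σ} {Δ} p =
  ∀ (A : Str σ) → TreeStr σ Δ A → ∀ a → Sat p A a → Closed A a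

tuples : (N n : ℕ) → List (Vec (Fin N) n)
tuples N zero    = [] L.∷ L.[]
tuples N (suc n) = concatMap (λ x → L.map (x ∷_) (tuples N n)) (allFin N)

count : ∀ {N n} {P : Vec (Fin N) n → Set} → Decidable P → ℕ
count {N} {n} d = length (filter d (tuples N n))

shiftEq : ∀ u v {k} l → u + v ≡ k → u + (v + l) ≡ k + l
shiftEq u v l e = trans (sym (+-assoc u v l)) (cong (_+ l) e)

{-# OPTIONS --safe #-}

-- p* is p with its witnesses ȳ turned into free variables, i.e. the formula
-- φ(x̄,ȳ) ∧ "{x̄,ȳ} is closed", which is self-contained by construction.  The
-- witnesses of p are unique: each yᵢ is the root or an ancestor of some xⱼ, and
-- walking up the tree from xⱼ every parent lies in the closed tuple x̄ȳ at a
-- position dictated by the atomic type, so uniqueness of parents (and of the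
-- root) pins every yᵢ down.  Hence projecting p*(A) onto the x̄-coordinates is a
-- bijection onto p(A), also fibrewise over any fixed prefix ū, which gives both
-- counting statements.
module Submission where

open import Defs
open import Data.Nat using (ℕ; zero; suc; _+_; _≤_)
open import Data.Nat.Properties using (+-identityʳ; m+n≡0⇒m≡0; m+n≡0⇒n≡0; +-0-commutativeMonoid)
open import Data.Fin using (Fin; zero; suc; _↑ʳ_; punchIn)
open import Data.Fin.Properties using (punchInᵢ≢i)
open import Data.Bool using (true; false; T)
open import Data.Vec using (Vec; []; _∷_; _++_; lookup; tabulate; cast)
open import Data.Vec.Properties
  using (lookup-++ˡ; lookup-++ʳ; tabulate∘lookup; tabulate-cong; ++-identityʳ-eqFree;
         ++-assoc-eqFree; cast-sym; cast-is-id; subst-is-cast; ∷-injective)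
open import Data.List as List using (List; []; _∷_; length; filter; concat)
open import Data.List.Properties using (filter-++; filter-none; length-++; map-tabulate)
import Data.List.Relation.Unary.All as All
open import Data.Product using (Σ; _×_; ∃; ∃!; _,_; proj₁; proj₂)
open import Data.Sum using (inj₁; inj₂)
open import Function using (_∘_; id)
open import Function.Bundles using (_⇔_; mk⇔; Equivalence)
open import Function.Construct.Identity using (⇔-id)
open import Relation.Binary.PropositionalEquality
  using (_≡_; refl; sym; trans; cong; cong₂; subst; subst₂; module ≡-Reasoning)
open import Relation.Nullary using (¬_; yes; no; does; contradiction)
open import Relation.Unary using (Decidable)
open import Algebra.Properties.CommutativeMonoid.Sum +-0-commutativeMonoid
  using (sum; sum-cong-≗; sum-remove; sum-replicate-zero)

open Equivalence using (to; from)
open ≡-Reasoning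

module _ {A : Set} {P : A → Set} (P? : Decidable P) where

  length-filter-map : ∀ {B : Set} (f : B → A) xs →
                      length (filter P? (List.map f xs)) ≡ length (filter (λ x → P? (f x)) xs)
  length-filter-map f []       = refl
  length-filter-map f (x ∷ xs) with does (P? (f x))
  ... | true  = cong suc (length-filter-map f xs)
  ... | false = length-filter-map f xs

  length-filter-concat-tabulate : ∀ {M} (F : Fin M → List A) →
    length (filter P? (concat (List.tabulate F))) ≡ sum (λ i → length (filter P? (F i)))
  length-filter-concat-tabulate {zero}  F = refl
  length-filter-concat-tabulate {suc M} F = begin
    length (filter P? (F zero List.++ rest))           ≡⟨ cong length (filter-++ P? (F zero) rest) ⟩
    length (filter P? (F zero) List.++ filter P? rest) ≡⟨ length-++ (filter P? (F zero)) ⟩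
    length (filter P? (F zero)) + length (filter P? rest)
      ≡⟨ cong (length (filter P? (F zero)) +_) (length-filter-concat-tabulate (F ∘ suc)) ⟩
    sum (λ i → length (filter P? (F i)))               ∎
    where rest = concat (List.tabulate (F ∘ suc))

count-∷ : ∀ {N n} {P : Vec (Fin N) (suc n) → Set} (P? : Decidable P) →
          count P? ≡ sum (λ x → count (λ v → P? (x ∷ v)))
count-∷ {N} {n} P? = begin
  length (filter P? (concat (List.map F (List.allFin N))))
    ≡⟨ cong (length ∘ filter P? ∘ concat) (map-tabulate id F) ⟩
  length (filter P? (concat (List.tabulate F)))
    ≡⟨ length-filter-concat-tabulate P? F ⟩
  sum (λ x → length (filter P? (F x)))
    ≡⟨ sum-cong-≗ (λ x → length-filter-map P? (x ∷_) (tuples N n)) ⟩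
  sum (λ x → count (λ v → P? (x ∷ v)))
    ∎
  where F = λ x → List.map (x ∷_) (tuples N n)

count-none : ∀ {N n} {P : Vec (Fin N) n → Set} (P? : Decidable P) → (∀ v → ¬ P v) → count P? ≡ 0
count-none {N} {n} P? none =
  cong length (filter-none P? {tuples N n} (All.tabulate (λ {v} _ → none v)))

count-unique : ∀ {N n} {P : Vec (Fin N) n → Set} (P? : Decidable P) → ∃! _≡_ P → count P? ≡ 1
count-unique {n = zero} P? ([] , p , _) with P? []
... | yes _  = refl
... | no ¬p  = contradiction p ¬p
count-unique {N = zero}  {suc n} P? (() ∷ _ , _)
count-unique {N = suc N} {suc n} P? (x ∷ v , p , unique) = begin
  count P?                           ≡⟨ count-∷ P? ⟩
  sum f                              ≡⟨ sum-remove f ⟩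
  f x + sum (λ y → f (punchIn x y))  ≡⟨ cong₂ _+_ f[x]≡1 others≡0 ⟩
  1                                  ∎
  where
  f : Fin (suc N) → ℕ
  f y = count (λ w → P? (y ∷ w))

  f[x]≡1 : f x ≡ 1
  f[x]≡1 = count-unique (λ w → P? (x ∷ w)) (v , p , proj₂ ∘ ∷-injective ∘ unique)

  others≡0 : sum (λ y → f (punchIn x y)) ≡ 0
  others≡0 = trans
    (sum-cong-≗ λ y → count-none (λ w → P? (punchIn x y ∷ w))
                                 λ w q → punchInᵢ≢i x y (sym (proj₁ (∷-injective (unique q)))))
    (sum-replicate-zero N)

record UniqueExtension {X : Set} {n l} (P : Vec X n → Set) (Q : Vec X (n + l) → Set) : Set where
  field
    extension⇔       : ∀ v → P v ⇔ ∃ λ (w : Vec X l) → Q (v ++ w)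
    extension-unique : ∀ v {w w′ : Vec X l} → Q (v ++ w) → Q (v ++ w′) → w ≡ w′
open UniqueExtension

UniqueExtension⇒∃! : ∀ {X n l} {P : Vec X n → Set} {Q : Vec X (n + l) → Set} →
  UniqueExtension P Q → ∀ v → P v ⇔ ∃! _≡_ (λ w → Q (v ++ w))
UniqueExtension⇒∃! ext v = mk⇔
  (λ p → let (w , q) = to (extension⇔ ext v) p in w , q , λ {_} q′ → extension-unique ext v q q′)
  (λ (w , q , _) → from (extension⇔ ext v) (w , q))

UniqueExtension-reindex : ∀ {X m n l} {P : Vec X n → Set} {Q : Vec X (n + l) → Set}
  (f : Vec X m → Vec X n) (g : Vec X (m + l) → Vec X (n + l)) →
  (∀ v w → g (v ++ w) ≡ f v ++ w) →
  UniqueExtension P Q → UniqueExtension (P ∘ f) (Q ∘ g)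
UniqueExtension-reindex {Q = Q} f g g-++ ext = record
  { extension⇔       = λ v → mk⇔
      (λ p → let (w , q) = to (extension⇔ ext (f v)) p in w , subst Q (sym (g-++ v w)) q)
      (λ (w , q) → from (extension⇔ ext (f v)) (w , subst Q (g-++ v w) q))
  ; extension-unique = λ v {w} {w′} q q′ →
      extension-unique ext (f v) (subst Q (g-++ v w) q) (subst Q (g-++ v w′) q′)
  }

count-UniqueExtension : ∀ {N n l} {P : Vec (Fin N) n → Set} {Q : Vec (Fin N) (n + l) → Set}
  (P? : Decidable P) (Q? : Decidable Q) → UniqueExtension P Q → count P? ≡ count Q?
count-UniqueExtension {n = zero} P? Q? ext with P? []
... | yes p = sym (count-unique Q? (to (UniqueExtension⇒∃! ext []) p))
... | no ¬p = sym (count-none Q? (λ w q → ¬p (from (extension⇔ ext []) (w , q))))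
count-UniqueExtension {n = suc n} P? Q? ext = begin
  count P?                              ≡⟨ count-∷ P? ⟩
  sum (λ x → count (λ v → P? (x ∷ v)))
    ≡⟨ sum-cong-≗ (λ x → count-UniqueExtension _ _
                           (UniqueExtension-reindex (x ∷_) (x ∷_) (λ _ _ → refl) ext)) ⟩
  sum (λ x → count (λ v → Q? (x ∷ v)))  ≡⟨ count-∷ Q? ⟨
  count Q?                              ∎

module _ {σ : Sig} {A : Str σ} (tree : IsTree A) where

  root-unique : ∀ {x y} → IsRoot A x → IsRoot A y → x ≡ y
  root-unique rx ry =
    let (_ , _ , unique) = proj₁ (proj₂ (proj₂ tree)) in trans (sym (unique rx)) (unique ry)

  parent-unique : ∀ {x y z} → Edge A y x → Edge A z x → y ≡ z
  parent-unique y→x z→x =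
    let (_ , _ , unique) = proj₁ (proj₂ (proj₂ (proj₂ tree))) _ (λ root → root _ y→x)
    in trans (sym (unique y→x)) (unique z→x)

  module _ {n} {c c′ : Vec (Fin (N A)) n}
           (sameEdges : ∀ i j → E A (lookup c i) (lookup c j) ≡ E A (lookup c′ i) (lookup c′ j)) where

    closed-agree-above-vertex : Closed A c → ∀ {m x s} → Path A m x (lookup c s) →
                                lookup c s ≡ lookup c′ s → Σ (Fin n) λ i → x ≡ lookup c i × x ≡ lookup c′ i
    closed-agree-above-vertex cl here            cs≡c′s = _ , refl , cs≡c′s
    closed-agree-above-vertex cl (step x→y y⇝cs) cs≡c′s with closed-agree-above-vertex cl y⇝cs cs≡c′s
    ... | j , refl , y≡c′j with cl _ j x→y
    ... | t , refl = t , refl , parent-unique x→y (subst (Edge A (lookup c′ t)) (sym y≡c′j) c′t→c′j)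
      where c′t→c′j = subst T (sameEdges t j) x→y

    closed-agree-above : Closed A c → (∀ i j → lookup c i ≡ lookup c j → i ≡ j) →
                         ∀ {m i s} → Path A m (lookup c i) (lookup c s) → lookup c s ≡ lookup c′ s →
                         lookup c i ≡ lookup c′ i
    closed-agree-above cl inj {i = i} ci⇝cs cs≡c′s with closed-agree-above-vertex cl ci⇝cs cs≡c′s
    ... | t , ci≡ct , ci≡c′t = trans ci≡c′t (cong (lookup c′) (sym (inj i t ci≡ct)))

    closed-agree-root : Closed A c′ → ∀ {i} → IsRoot A (lookup c i) → lookup c i ≡ lookup c′ i
    closed-agree-root cl′ {i} root = root-unique root root′
      where
      root′ : IsRoot A (lookup c′ i)
      root′ z z→c′i with cl′ z i z→c′i
      ... | t , refl = root (lookup c t) (subst T (sym (sameEdges t i)) z→c′i)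

SatClosed : ∀ {σ n} (A : Str σ) → Conj σ n → Vec (Fin (N A)) n → Set
SatClosed A φ c = SatConj A φ c × Closed A c

closedExtension-unique : ∀ {σ} {A : Str σ} → IsTree A →
  ∀ {k m} {φ : Conj σ (k + m)} {a : Vec (Fin (N A)) k} {b b′ : Vec (Fin (N A)) m} →
  (∀ j → InCl A (lookup b j) a) → SatClosed A φ (a ++ b) → SatClosed A φ (a ++ b′) → b ≡ b′
closedExtension-unique {A = A} tree {k} {a = a} {b} {b′} b⊆cl[a] (sat , cl) (sat′ , cl′) = begin
  b                     ≡⟨ tabulate∘lookup b ⟨
  tabulate (lookup b)   ≡⟨ tabulate-cong agree ⟩
  tabulate (lookup b′)  ≡⟨ tabulate∘lookup b′ ⟩
  b′                    ∎
  where
  sameEdges : ∀ i j → E A (lookup (a ++ b) i) (lookup (a ++ b) j)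
                    ≡ E A (lookup (a ++ b′) i) (lookup (a ++ b′) j)
  sameEdges i j = trans (proj₁ (proj₂ sat) i j) (sym (proj₁ (proj₂ sat′) i j))

  agree-at-↑ʳ : ∀ j → lookup (a ++ b) (k ↑ʳ j) ≡ lookup (a ++ b′) (k ↑ʳ j) →
                lookup b j ≡ lookup b′ j
  agree-at-↑ʳ j eq = trans (sym (lookup-++ʳ a b j)) (trans eq (lookup-++ʳ a b′ j))

  agree-below-a : ∀ {n j t} → Path A n (lookup b j) (lookup a t) → lookup b j ≡ lookup b′ j
  agree-below-a {n} {j} {t} bj⇝at = agree-at-↑ʳ j
    (closed-agree-above tree {c = a ++ b} {a ++ b′} sameEdges cl (proj₁ sat)
      (subst₂ (Path A n) (sym (lookup-++ʳ a b j)) (sym (lookup-++ˡ a b t)) bj⇝at)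
      (trans (lookup-++ˡ a b t) (sym (lookup-++ˡ a b′ t))))

  agree : ∀ j → lookup b j ≡ lookup b′ j
  agree j with b⊆cl[a] j
  ... | inj₁ (t , bj≡at)        = agree-below-a (subst (λ x → Path A 0 x (lookup a t)) (sym bj≡at) here)
  ... | inj₂ (inj₁ root)        = agree-at-↑ʳ j
    (closed-agree-root tree {c = a ++ b} {a ++ b′} sameEdges cl′
      (subst (IsRoot A) (sym (lookup-++ʳ a b j)) root))
  ... | inj₂ (inj₂ (_ , _ , p)) = agree-below-a p

weaken₀ : ∀ {σ n} → Conj σ n → Conj σ (n + 0)
weaken₀ {σ} {n} = subst (Conj σ) (sym (+-identityʳ n))

++[]≡subst : ∀ {X : Set} {n} (c : Vec X n) → c ++ [] ≡ subst (Vec X) (sym (+-identityʳ n)) c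
++[]≡subst {n = n} c =
  trans (sym (cast-sym _ (++-identityʳ-eqFree c))) (sym (subst-is-cast (sym (+-identityʳ n)) c))

module _ {σ : Sig} (A : Str σ) where

  SatConj-subst : ∀ {n n′} (e : n ≡ n′) {φ : Conj σ n} {c} →
                  SatConj A (subst (Conj σ) e φ) (subst (Vec (Fin (N A))) e c) ⇔ SatConj A φ c
  SatConj-subst refl = ⇔-id _

  Closed-subst : ∀ {n n′} (e : n ≡ n′) {c} → Closed A (subst (Vec (Fin (N A))) e c) ⇔ Closed A c
  Closed-subst refl = ⇔-id _

  SatConj-weaken₀ : ∀ {n} {φ : Conj σ n} c → SatConj A (weaken₀ φ) (c ++ []) ⇔ SatConj A φ c
  SatConj-weaken₀ {n} c rewrite ++[]≡subst c = SatConj-subst (sym (+-identityʳ n))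

  Closed-++[] : ∀ {n} (c : Vec (Fin (N A)) n) → Closed A (c ++ []) ⇔ Closed A c
  Closed-++[] {n} c rewrite ++[]≡subst c = Closed-subst (sym (+-identityʳ n))

freeWitnesses : ∀ {σ Δ k} (p : ClosureType σ Δ k) → ClosureType σ Δ (k + m p)
freeWitnesses {k = k} p = record
  { m      = 0
  ; φ      = weaken₀ (φ p)
  ; atomic = let (A , TA , c , sat) = atomic p
             in A , TA , c ++ [] , from (SatConj-weaken₀ A c) sat
  ; inCl   = λ _ _ _ _ _ ()
  ; empty  = λ k+m≡0 → trans (sym (m+n≡0⇒n≡0 k k+m≡0)) (empty p (m+n≡0⇒m≡0 k k+m≡0))
  }

module _ {σ Δ k} (p : ClosureType σ Δ k) where

  Sat-freeWitnesses : ∀ A c → Sat (freeWitnesses p) A c ⇔ SatClosed A (φ p) c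
  Sat-freeWitnesses A c = mk⇔
    (λ { ([] , sat , cl) → to (SatConj-weaken₀ A c) sat , to (Closed-++[] A c) cl })
    (λ (sat , cl) → [] , from (SatConj-weaken₀ A c) sat , from (Closed-++[] A c) cl)

  freeWitnesses-selfContained : SelfContained (freeWitnesses p)
  freeWitnesses-selfContained A _ c sat = proj₂ (to (Sat-freeWitnesses A c) sat)

  freeWitnesses-UniqueExtension : ∀ {A} → TreeStr σ Δ A →
                                  UniqueExtension (Sat p A) (Sat (freeWitnesses p) A)
  freeWitnesses-UniqueExtension {A} TA = record
    { extension⇔       = λ a → mk⇔
        (λ (b , sat) → b , from (Sat-freeWitnesses A (a ++ b)) sat)
        (λ (b , sat) → b , to (Sat-freeWitnesses A (a ++ b)) sat)
    ; extension-unique = λ a {b} {b′} q q′ →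
        let sat = to (Sat-freeWitnesses A (a ++ b)) q in
        closedExtension-unique (proj₁ TA) {a = a} {b} {b′}
          (inCl p A TA a b (proj₁ sat)) sat (to (Sat-freeWitnesses A (a ++ b′)) q′)
    }

cast-++-assoc : ∀ {X : Set} {u v k l} (e : u + v ≡ k) .(e′ : u + (v + l) ≡ k + l)
                (a : Vec X u) (b : Vec X v) (w : Vec X l) →
                cast e′ (a ++ (b ++ w)) ≡ cast e (a ++ b) ++ w
cast-++-assoc refl _ a b w = begin
  cast _ (a ++ (b ++ w))   ≡⟨ cast-sym _ (++-assoc-eqFree a b w) ⟩
  (a ++ b) ++ w            ≡⟨ cong (_++ w) (cast-is-id refl (a ++ b)) ⟨
  cast refl (a ++ b) ++ w  ∎

lemma5p12 : (σ : Sig) (Δ : ℕ) → 1 ≤ Δ → {k : ℕ} (p : ClosureType σ Δ k) →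
    Σ ℕ λ l → Σ (ClosureType σ Δ (k + l)) λ p* →
      SelfContained p* ×
      (∀ (A : Str σ) → TreeStr σ Δ A → (a : Vec (Fin (N A)) k) →
         Sat p A a ⇔ ∃! _≡_ (λ b → Sat p* A (a ++ b))) ×
      (∀ (A : Str σ) → TreeStr σ Δ A →
         (d : Decidable (Sat p A)) (d* : Decidable (Sat p* A)) →
         count d ≡ count d*) ×
      (∀ (A : Str σ) → TreeStr σ Δ A →
         (u v : ℕ) (e : u + v ≡ k) (a : Vec (Fin (N A)) u) →
         (d : Decidable (λ b → Sat p A (cast e (a ++ b)))) →
         (d* : Decidable (λ c → Sat p* A (cast (shiftEq u v l e) (a ++ c)))) →
         count d ≡ count d*)
lemma5p12 σ Δ _ p =
  m p , freeWitnesses p , freeWitnesses-selfContained p ,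
  (λ A TA → UniqueExtension⇒∃! (freeWitnesses-UniqueExtension p TA)) ,
  (λ A TA d d* → count-UniqueExtension d d* (freeWitnesses-UniqueExtension p TA)) ,
  (λ A TA u v e a d d* → count-UniqueExtension d d*
     (UniqueExtension-reindex (λ b → cast e (a ++ b)) (λ c → cast (shiftEq u v (m p) e) (a ++ c))
                              (cast-++-assoc e _ a) (freeWitnesses-UniqueExtension p TA)))
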